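{- Let $G$ be a finite connected graph and $A$ a vertex of $G$. Then the sages lose the hat guessing game on $G$ with the hint $A-1$ if and only if $G$ is a tree.
   Context: Hat guessing game: a sage sits at each vertex of a finite graph; hat colors are $H=\{0,1,2\}$; each sage sees only his neighbours' hats and guesses his own color by a deterministic function of the neighbours' colors, fixed in advance. Hint $A-1$: a color $i\in H$ is announced in advance to everyone and only placements $C$ with $C(A)\ne i$ occur. The sages win with the hint $A-1$ if for every announced $i$ there is a strategy such that every placement with $C(A)\neq i$ has at least one correct guess (by permuting color names, equivalent to this for a single $i$); otherwise they lose. -}

module Defs where

open import Data.Nat using (ℕ; _≤_)
open import Data.Fin using (Fin)
open import Data.Bool using (Bool; true; false)
open import Data.List using (List; []; _∷_; _++_; length)
open import Data.List.Relation.Unary.Unique.Propositional using (Unique)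
open import Data.Product using (Σ; ∃; _×_)
open import Data.Unit using (⊤)
open import Relation.Nullary using (¬_)
open import Relation.Binary.PropositionalEquality using (_≡_; _≢_)

record Graph (n : ℕ) : Set where
  field
    adj    : Fin n → Fin n → Bool
    sym    : ∀ u v → adj u v ≡ adj v u
    irrefl : ∀ v → adj v v ≡ false

module _ {n : ℕ} (G : Graph n) where
  open Graph G

  Adj : Fin n → Fin n → Set
  Adj u v = adj u v ≡ true

  data Walk : Fin n → Fin n → Set where
    []  : ∀ {u} → Walk u u
    _∷_ : ∀ {u v w} → Adj u v → Walk v w → Walk u w

  Connected : Set
  Connected = ∀ u v → Walk u v

  AdjChain : List (Fin n) → Set
  AdjChain []             = ⊤
  AdjChain (x ∷ [])       = ⊤
  AdjChain (x ∷ y ∷ xs)   = Adj x y × AdjChain (y ∷ xs)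

  HasCycle : Set
  HasCycle = Σ (Fin n) λ v → Σ (List (Fin n)) λ ws →
               (2 ≤ length ws) × Unique (v ∷ ws) × AdjChain (v ∷ ws ++ v ∷ [])

  IsTree : Set
  IsTree = Connected × ¬ HasCycle

  Colour : Set
  Colour = Fin 3

  Placement : Set
  Placement = Fin n → Colour

  record Strategy : Set where
    field
      guess : Fin n → Placement → Colour
      local : ∀ v (C C′ : Placement) → (∀ u → Adj v u → C u ≡ C′ u) →
              guess v C ≡ guess v C′

  WinsWithHintFor : Fin n → Colour → Set
  WinsWithHintFor A i = Σ Strategy λ s →
    ∀ (C : Placement) → C A ≢ i → ∃ λ v → Strategy.guess s v C ≡ C v

  -- the sages win with the hint A-1: for every announced colour i there is a
  -- winning strategy
  SagesWinWithHint : Fin n → Set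
  SagesWinWithHint A = ∀ (i : Colour) → WinsWithHintFor A i

  SagesLoseWithHint : Fin n → Set
  SagesLoseWithHint A = ¬ SagesWinWithHint A

-- Cycles win.  A simple path from A meets a cycle only at its last vertex y, and
-- the hint travels along it: a sage whose hat is known to be nonzero answers 1 if
-- the next hat is 0 and 2 otherwise, while the next sage answers 0 whenever the
-- previous hat is 2 and otherwise follows his own rule.  If both err, the first hat
-- is 1 and the next one is nonzero.  On the cycle a fixed table of rules wins as soon
-- as the hat of y is nonzero, which is checked on the finitely many states that can
-- occur while everybody errs.  Renaming colours covers every announced colour.
--
-- Trees lose.  By induction on a set S of sages, every strategy reading only
-- neighbours in S is defeated by a placement with C A ≠ i on which all of S err.
-- An end e of a maximal path in S (started at A if A ∈ S) has no neighbour in S, or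
-- exactly one neighbour p and e ≠ A, since a second one would close a cycle.  An
-- isolated e gets a colour avoiding its guess and i.  Otherwise p first answers the
-- majority of his answers over the three hats of e; as p errs, at most one hat of e
-- makes p right, and a colour remains for e that also avoids the guess of e.

module Submission where

open import Defs
open import Data.Nat using (ℕ; _<_; _≤_; s≤s; z≤n)
open import Data.Nat.Induction using (<-wellFounded)
open import Data.Nat.Properties using (suc-injective)
open import Data.Fin using (Fin)
open import Data.Fin.Patterns using (0F; 1F; 2F)
open import Data.Fin.Properties using (_≟_; all?)
open import Data.Fin.Permutation using (Permutation′; _⟨$⟩ʳ_; _⟨$⟩ˡ_; inverseʳ; transpose)
open import Data.Bool using (true)
import Data.Bool.Properties as Bool
open import Data.List using (List; []; _∷_; _++_; length; filter; allFin)
open import Data.List.Properties using (++-assoc; filter-notAll)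
open import Data.List.Membership.Propositional using (_∈_; _∉_; find)
open import Data.List.Membership.Propositional.Properties using (∈-filter⁺; ∈-filter⁻; ∈-allFin; ∈-∃++)
open import Data.List.Relation.Unary.Any using (Any; here; there; satisfied)
import Data.List.Relation.Unary.Any as Any
open import Data.List.Relation.Unary.All using (All; []; _∷_)
import Data.List.Relation.Unary.All as All
open import Data.List.Relation.Unary.All.Properties using (¬Any⇒All¬; ¬All⇒Any¬; ++⁻ˡ; ++⁻ʳ)
open import Data.List.Relation.Unary.AllPairs using ([]; _∷_)
open import Data.List.Relation.Unary.Unique.Propositional using (Unique)
import Data.List.Relation.Unary.Unique.Propositional.Properties as Unique
open import Data.List.Relation.Binary.Permutation.Propositional using (_↭_; ↭-refl; ↭-sym; ↭⇒↭ₛ)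
open import Data.List.Relation.Binary.Permutation.Propositional.Properties using (↭-length; ∈-resp-↭; ++-comm)
import Data.List.Relation.Binary.Permutation.Setoid.Properties as Permutationₛ
open import Data.Vec.Functional using (updateAt)
open import Data.Vec.Functional.Properties using (updateAt-updates; updateAt-minimal)
open import Data.Product using (Σ; ∃; _×_; _,_; proj₁; proj₂)
open import Data.Sum using (_⊎_; inj₁; inj₂; [_,_])
open import Data.Unit using (⊤; tt)
open import Data.Empty using (⊥; ⊥-elim)
open import Function using (_∘_; const)
open import Function.Bundles using (_⇔_; mk⇔)
open import Induction.WellFounded using (Acc; acc)
open import Relation.Nullary using (¬_; Dec; yes; no; ¬?)
open import Relation.Nullary.Decidable using (toWitness; decidable-stable; _×-dec_; _→-dec_)
open import Relation.Binary.PropositionalEquality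
  using (_≡_; _≢_; refl; sym; trans; cong; cong₂; subst; setoid; ≢-sym)

module _ {A : Set} where

  lastOf : A → List A → A
  lastOf x []       = x
  lastOf _ (y ∷ ys) = lastOf y ys

  Unique-++⁻ˡ : ∀ xs {ys : List A} → Unique (xs ++ ys) → Unique xs
  Unique-++⁻ˡ []       _           = []
  Unique-++⁻ˡ (x ∷ xs) (x∉ ∷ uniq) = ++⁻ˡ xs x∉ ∷ Unique-++⁻ˡ xs uniq

  Unique-++⁻ʳ : ∀ xs {ys : List A} → Unique (xs ++ ys) → Unique ys
  Unique-++⁻ʳ []       uniq       = uniq
  Unique-++⁻ʳ (x ∷ xs) (_ ∷ uniq) = Unique-++⁻ʳ xs uniq

  Unique-resp-↭ : ∀ {xs ys : List A} → xs ↭ ys → Unique xs → Unique ys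
  Unique-resp-↭ xs↭ys = Permutationₛ.Unique-resp-↭ (setoid A) (↭⇒↭ₛ xs↭ys)

  2≤length-∷-∷ʳ : ∀ (x : A) xs y → 2 ≤ length (x ∷ xs ++ y ∷ [])
  2≤length-∷-∷ʳ x []      y = s≤s (s≤s z≤n)
  2≤length-∷-∷ʳ x (_ ∷ _) y = s≤s (s≤s z≤n)

module Paths {n : ℕ} (G : Graph n) where

  open Graph G using (adj) renaming (sym to adj-sym; irrefl to adj-irrefl)
  open import Data.List.Membership.DecPropositional (_≟_ {n}) using (_∈?_)

  private
    V : Set
    V = Fin n

  Adj-sym : ∀ {u v} → Adj G u v → Adj G v u
  Adj-sym {u} {v} uv = trans (adj-sym v u) uv

  Adj-irrefl : ∀ {v} → ¬ Adj G v v
  Adj-irrefl {v} vv with trans (sym vv) (adj-irrefl v)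
  ... | ()

  Adj⇒≢ : ∀ {u v} → Adj G u v → u ≢ v
  Adj⇒≢ uv refl = Adj-irrefl uv

  Adj? : ∀ u v → Dec (Adj G u v)
  Adj? u v = adj u v Bool.≟ true

  chain-split : ∀ xs {y ys} → AdjChain G (xs ++ y ∷ ys) →
                AdjChain G (xs ++ y ∷ []) × AdjChain G (y ∷ ys)
  chain-split []            ch       = tt , ch
  chain-split (x ∷ [])      (a , ch) = (a , tt) , ch
  chain-split (x ∷ x′ ∷ xs) (a , ch) with chain-split (x′ ∷ xs) ch
  ... | front , back = (a , front) , back

  chain-join : ∀ xs {y ys} → AdjChain G (xs ++ y ∷ []) → AdjChain G (y ∷ ys) →
               AdjChain G (xs ++ y ∷ ys)
  chain-join []            _           back = back
  chain-join (x ∷ [])      (a , _)     back = a , back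
  chain-join (x ∷ x′ ∷ xs) (a , front) back = a , chain-join (x′ ∷ xs) front back

  chain-last : ∀ x xs {y} → AdjChain G (x ∷ xs ++ y ∷ []) → Adj G (lastOf x xs) y
  chain-last x []        (a , _)  = a
  chain-last x (x′ ∷ xs) (_ , ch) = chain-last x′ xs ch

  backEdge⇒cycle : ∀ {x q ys z} → Unique (x ∷ q ∷ ys) → AdjChain G (x ∷ q ∷ ys) →
                   z ∈ ys → Adj G x z → HasCycle G
  backEdge⇒cycle {x} {q} {z = z} uniq ch z∈ys xz with ∈-∃++ z∈ys
  ... | as , bs , refl = x , q ∷ as ++ z ∷ [] , 2≤length-∷-∷ʳ q as z , uniqueCycle , closedCycle
    where
    reassoc : (x ∷ q ∷ as ++ z ∷ []) ++ bs ≡ x ∷ q ∷ as ++ z ∷ bs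
    reassoc = cong (λ t → x ∷ q ∷ t) (++-assoc as (z ∷ []) bs)

    uniqueCycle : Unique (x ∷ q ∷ as ++ z ∷ [])
    uniqueCycle = Unique-++⁻ˡ (x ∷ q ∷ as ++ z ∷ []) (subst Unique (sym reassoc) uniq)

    closedCycle : AdjChain G (x ∷ (q ∷ as ++ z ∷ []) ++ x ∷ [])
    closedCycle = subst (λ t → AdjChain G (x ∷ q ∷ t)) (sym (++-assoc as (z ∷ []) (x ∷ [])))
      (chain-join (x ∷ q ∷ as) (proj₁ (chain-split (x ∷ q ∷ as) ch)) (Adj-sym xz , tt))

  rotateCycle : ∀ {v ws y} → AdjChain G (v ∷ ws ++ v ∷ []) → y ∈ v ∷ ws →
                Σ (List V) λ rs → (y ∷ rs) ↭ (v ∷ ws) × AdjChain G (y ∷ rs ++ y ∷ [])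
  rotateCycle ch y∈ with ∈-∃++ y∈
  ... | [] , vs , refl = vs , ↭-refl , ch
  ... | u ∷ us , vs , refl with chain-split (u ∷ us) {ys = vs ++ u ∷ []}
                                    (subst (λ t → AdjChain G (u ∷ t)) (++-assoc us _ (u ∷ [])) ch)
  ...   | toY , fromY = vs ++ u ∷ us , ++-comm (_ ∷ vs) (u ∷ us) ,
                        subst (λ t → AdjChain G (_ ∷ t)) (sym (++-assoc vs (u ∷ us) (_ ∷ [])))
                          (chain-join (_ ∷ vs) fromY toY)

  stem : ∀ {u y} → Walk G u y → List V
  stem []            = []
  stem (_∷_ {u} _ w) = u ∷ stem w

  start∈stem++ : ∀ {u y L} (w : Walk G u y) → y ∈ L → u ∈ stem w ++ L
  start∈stem++ []      y∈L = y∈L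
  start∈stem++ (_ ∷ _) _   = here refl

  suffixFrom : ∀ {u x y} (w : Walk G u y) → x ∈ stem w →
               Σ (Walk G x y) λ w′ → ∃ λ pre → stem w ≡ pre ++ stem w′
  suffixFrom (a ∷ w)       (here refl) = a ∷ w , [] , refl
  suffixFrom (_∷_ {u} _ w) (there x∈) with suffixFrom w x∈
  ... | w′ , pre , eq = w′ , u ∷ pre , cong (u ∷_) eq

  record PathInto (u : V) (L : List V) : Set where
    field
      {target} : V
      target∈  : target ∈ L
      path     : Walk G u target
      simple   : Unique (stem path)
      outside  : All (_∉ L) (stem path)

  open PathInto public

  private
    pathInto-via : ∀ {u v L} → Adj G u v → u ∉ L → PathInto v L → PathInto u L
    pathInto-via {u} a u∉L en with u ∈? stem (path en)
    ... | no fresh = record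
      { target∈ = target∈ en ; path = a ∷ path en
      ; simple = ¬Any⇒All¬ _ fresh ∷ simple en ; outside = u∉L ∷ outside en }
    ... | yes loop with suffixFrom (path en) loop
    ...   | w′ , pre , eq = record
      { target∈ = target∈ en ; path = w′
      ; simple = Unique-++⁻ʳ pre (subst Unique eq (simple en))
      ; outside = ++⁻ʳ pre (subst (All (_∉ _)) eq (outside en)) }

  pathInto : ∀ {u v L} → Walk G u v → v ∈ L → PathInto u L
  pathInto {u} {L = L} w v∈L with u ∈? L
  ... | yes u∈L = record { target∈ = u∈L ; path = [] ; simple = [] ; outside = [] }
  pathInto []      v∈L | no u∉L = ⊥-elim (u∉L v∈L)
  pathInto (a ∷ w) v∈L | no u∉L = pathInto-via a u∉L (pathInto w v∈L)

hintGuess : Fin 3 → Fin 3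
hintGuess 0F = 1F
hintGuess _  = 2F

guarded : Fin 3 → Fin 3 → Fin 3
guarded 2F _ = 0F
guarded _  x = x

-- The hint moves from a sage with hat a to his neighbour with hat b and own rule x
-- when both guess wrongly.
hint-passes : ∀ a b x → a ≢ 0F → hintGuess b ≢ a → guarded a x ≢ b →
              b ≢ 0F × guarded a x ≡ x
hint-passes 0F _  _ a≢0 _      _      = ⊥-elim (a≢0 refl)
hint-passes 1F 0F _ _   wrongA _      = ⊥-elim (wrongA refl)
hint-passes 1F 1F _ _   _      _      = (λ ()) , refl
hint-passes 1F 2F _ _   _      _      = (λ ()) , refl
hint-passes 2F 0F _ _   _      wrongB = ⊥-elim (wrongB refl)
hint-passes 2F 1F _ _   wrongA _      = ⊥-elim (wrongA refl)
hint-passes 2F 2F _ _   wrongA _      = ⊥-elim (wrongA refl)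

module Strategies {n : ℕ} (G : Graph n) where

  open Paths G

  private
    V : Set
    V = Fin n

  record LocalGuess (v : V) : Set where
    field
      guessAt : Placement G → Fin 3
      localAt : ∀ C C′ → (∀ u → Adj G v u → C u ≡ C′ u) → guessAt C ≡ guessAt C′

  open LocalGuess

  reading : ∀ {v u} → Adj G v u → LocalGuess v
  reading {u = u} vu = record { guessAt = λ C → C u ; localAt = λ C C′ agree → agree u vu }

  lift₁ : ∀ {v} → (Fin 3 → Fin 3) → LocalGuess v → LocalGuess v
  lift₁ f g = record
    { guessAt = λ C → f (guessAt g C)
    ; localAt = λ C C′ agree → cong f (localAt g C C′ agree) }

  lift₂ : ∀ {v} → (Fin 3 → Fin 3 → Fin 3) → LocalGuess v → LocalGuess v → LocalGuess v
  lift₂ f g h = record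
    { guessAt = λ C → f (guessAt g C) (guessAt h C)
    ; localAt = λ C C′ agree → cong₂ f (localAt g C C′ agree) (localAt h C C′ agree) }

  guessOf : Strategy G → (v : V) → LocalGuess v
  guessOf s v = record { guessAt = Strategy.guess s v ; localAt = Strategy.local s v }

  silent : Strategy G
  silent = record { guess = λ _ _ → 0F ; local = λ _ _ _ _ → refl }

  override : Strategy G → (v : V) → LocalGuess v → Strategy G
  override s v g = record { guess = guess′ ; local = local′ }
    where
    guess′ : V → Placement G → Fin 3
    guess′ u C with u ≟ v
    ... | yes refl = guessAt g C
    ... | no _     = Strategy.guess s u C

    local′ : ∀ u C C′ → (∀ w → Adj G u w → C w ≡ C′ w) → guess′ u C ≡ guess′ u C′
    local′ u C C′ agree with u ≟ v
    ... | yes refl = localAt g C C′ agree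
    ... | no _     = Strategy.local s u C C′ agree

  override-≡ : ∀ s v g C → Strategy.guess (override s v g) v C ≡ guessAt g C
  override-≡ s v g C with v ≟ v
  ... | yes refl = refl
  ... | no v≢v   = ⊥-elim (v≢v refl)

  override-≢ : ∀ s {v} g {u} C → u ≢ v →
               Strategy.guess (override s v g) u C ≡ Strategy.guess s u C
  override-≢ s {v} g {u} C u≢v with u ≟ v
  ... | yes u≡v = ⊥-elim (u≢v u≡v)
  ... | no _    = refl

  EveryoneWrong : Strategy G → Placement G → List V → Set
  EveryoneWrong s C L = All (λ v → Strategy.guess s v C ≢ C v) L

  WinsAmong : Strategy G → List V → V → Set
  WinsAmong s L h = ∀ C → C h ≢ 0F → ¬ EveryoneWrong s C L

  wrong-override : ∀ {s v g C L} → All (v ≢_) L →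
                   EveryoneWrong (override s v g) C L → EveryoneWrong s C L
  wrong-override []          []               = []
  wrong-override (v≢u ∷ v≢L) (wrong ∷ wrongs) =
    (λ right → wrong (trans (override-≢ _ _ _ (≢-sym v≢u)) right)) ∷ wrong-override v≢L wrongs

  peel : ∀ {s v g C L} → All (v ≢_) L → EveryoneWrong (override s v g) C (v ∷ L) →
         guessAt g C ≢ C v × EveryoneWrong s C L
  peel {s} {v} {g} {C} v≢L (wrong ∷ wrongs) =
    (λ right → wrong (trans (override-≡ s v g C) right)) , wrong-override v≢L wrongs

  passHint : ∀ {a b} → Strategy G → Adj G a b → Strategy G
  passHint {a} {b} s ab =
    override (override s b (lift₂ guarded (reading (Adj-sym ab)) (guessOf s b)))
             a (lift₁ hintGuess (reading ab))

  passHint-wins : ∀ {a b s L} (ab : Adj G a b) → b ∈ L → All (a ≢_) L →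
                  WinsAmong s L b → WinsAmong (passHint s ab) (a ∷ L) a
  passHint-wins {a} {b} {s} {L} ab b∈L a≢L wins C Ca≢0 wrong
    with peel a≢L wrong
  ... | wrongA , wrongsL
    with hint-passes (C a) (C b) (Strategy.guess s b C) Ca≢0 wrongA
           (λ right → All.lookup wrongsL b∈L (trans (override-≡ s b _ C) right))
  ... | Cb≢0 , unguarded = wins C Cb≢0 (All.tabulate restore)
    where
    restore : ∀ {v} → v ∈ L → Strategy.guess s v C ≢ C v
    restore {v} v∈L right with v ≟ b
    ... | yes refl = All.lookup wrongsL v∈L (trans (override-≡ s b _ C) (trans unguarded right))
    ... | no v≢b   = All.lookup wrongsL v∈L (trans (override-≢ s _ C v≢b) right)

  passHintAlong : ∀ {u y} → Walk G u y → Strategy G → Strategy G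
  passHintAlong []       s = s
  passHintAlong (uv ∷ w) s = passHint (passHintAlong w s) uv

  passHintAlong-wins : ∀ {u y L} (w : Walk G u y) s → Unique (stem w ++ L) → y ∈ L →
                       WinsAmong s L y → WinsAmong (passHintAlong w s) (stem w ++ L) u
  passHintAlong-wins []       s _           _   wins = wins
  passHintAlong-wins (uv ∷ w) s (u≢ ∷ uniq) y∈L wins =
    passHint-wins uv (start∈stem++ w y∈L) u≢ (passHintAlong-wins w s uniq y∈L wins)

apexGuess : Fin 3 → Fin 3 → Fin 3
apexGuess 0F _  = 2F
apexGuess 1F _  = 1F
apexGuess 2F 1F = 2F
apexGuess 2F _  = 1F

firstGuess : Fin 3 → Fin 3 → Fin 3
firstGuess 1F 0F = 2F
firstGuess 1F _  = 0F
firstGuess 2F 0F = 2F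
firstGuess 2F _  = 1F
firstGuess 0F _  = 0F

interiorGuess : Fin 3 → Fin 3 → Fin 3
interiorGuess 2F 0F = 2F
interiorGuess 2F _  = 1F
interiorGuess _  _  = 0F

lastGuess : Fin 3 → Fin 3 → Fin 3
lastGuess 0F 2F = 2F
lastGuess 2F a  = a
lastGuess _  _  = 0F

-- The states reachable while every sage of the cycle errs: a and e are the hats
-- of the apex y and of c₁, b and c those of the previous and the current vertex.
CycleInvariant : Fin 3 → Fin 3 → Fin 3 → Fin 3 → Set
CycleInvariant 1F 0F b c = b ≡ 0F × c ≡ 0F
CycleInvariant 1F 1F _ _ = ⊤
CycleInvariant 1F 2F b c = b ≡ hintGuess c
CycleInvariant 2F 0F _ _ = ⊤
CycleInvariant 2F 1F b c = b ≡ 1F × c ≡ 0F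
CycleInvariant 2F 2F b c = b ≡ hintGuess c
CycleInvariant 0F _  _ _ = ⊥

cycleInvariant? : ∀ a e b c → Dec (CycleInvariant a e b c)
cycleInvariant? 1F 0F b c = (b ≟ 0F) ×-dec (c ≟ 0F)
cycleInvariant? 1F 1F _ _ = yes tt
cycleInvariant? 1F 2F b c = b ≟ hintGuess c
cycleInvariant? 2F 0F _ _ = yes tt
cycleInvariant? 2F 1F b c = (b ≟ 1F) ×-dec (c ≟ 0F)
cycleInvariant? 2F 2F b c = b ≟ hintGuess c
cycleInvariant? 0F _  _ _ = no λ ()

cycleInvariant-start : ∀ a e d → a ≢ 0F → firstGuess a d ≢ e → CycleInvariant a e e d
cycleInvariant-start = toWitness {a? = all? λ a → all? λ e → all? λ d →
  ¬? (a ≟ 0F) →-dec ¬? (firstGuess a d ≟ e) →-dec cycleInvariant? a e e d} tt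

cycleInvariant-step : ∀ a e b c d → CycleInvariant a e b c → interiorGuess b d ≢ c →
                      CycleInvariant a e c d
cycleInvariant-step = toWitness {a? = all? λ a → all? λ e → all? λ b → all? λ c → all? λ d →
  cycleInvariant? a e b c →-dec ¬? (interiorGuess b d ≟ c) →-dec cycleInvariant? a e c d} tt

cycleInvariant-close : ∀ a e b c → CycleInvariant a e b c → lastGuess b a ≢ c →
                       apexGuess e c ≢ a → ⊥
cycleInvariant-close = toWitness {a? = all? λ a → all? λ e → all? λ b → all? λ c →
  cycleInvariant? a e b c →-dec ¬? (lastGuess b a ≟ c) →-dec ¬? (apexGuess e c ≟ a) →-dec
  no λ ()} tt

module CycleWins {n : ℕ} (G : Graph n) where

  open Paths G
  open Strategies G

  tailStrategy : ∀ y prev z zs → AdjChain G (prev ∷ z ∷ zs ++ y ∷ []) → Strategy G → Strategy G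
  tailStrategy y prev z []       (pz , zy , _) s =
    override s z (lift₂ lastGuess (reading (Adj-sym pz)) (reading zy))
  tailStrategy y prev z (w ∷ zs) (pz , ch)     s =
    override (tailStrategy y z w zs ch s) z
             (lift₂ interiorGuess (reading (Adj-sym pz)) (reading (proj₁ ch)))

  tailStrategy-invariant : ∀ {y e s C} prev z zs (ch : AdjChain G (prev ∷ z ∷ zs ++ y ∷ [])) →
    Unique (z ∷ zs) → CycleInvariant (C y) e (C prev) (C z) →
    EveryoneWrong (tailStrategy y prev z zs ch s) C (z ∷ zs) →
    ∃ λ b → CycleInvariant (C y) e b (C (lastOf z zs)) × lastGuess b (C y) ≢ C (lastOf z zs)
  tailStrategy-invariant {C = C} prev z [] _ _ inv wrongs with peel [] wrongs
  ... | wrongZ , _ = C prev , inv , wrongZ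
  tailStrategy-invariant {y} {e} {C = C} prev z (w ∷ zs) (_ , ch) (z≢ ∷ uniq) inv wrongs
    with peel z≢ wrongs
  ... | wrongZ , wrongsRest =
    tailStrategy-invariant z w zs ch uniq
      (cycleInvariant-step (C y) e (C prev) (C z) (C w) inv wrongZ) wrongsRest

  cycleStrategy : ∀ y c₁ c₂ ds → AdjChain G (y ∷ c₁ ∷ c₂ ∷ ds ++ y ∷ []) → Strategy G
  cycleStrategy y c₁ c₂ ds (yc₁ , c₁c₂ , ch) =
    override (override (tailStrategy y c₁ c₂ ds (c₁c₂ , ch) silent)
                       c₁ (lift₂ firstGuess (reading (Adj-sym yc₁)) (reading c₁c₂)))
             y (lift₂ apexGuess (reading yc₁) (reading (Adj-sym (chain-last c₂ ds ch))))

  cycleStrategy-wins : ∀ {y c₁ c₂ ds} (ch : AdjChain G (y ∷ c₁ ∷ c₂ ∷ ds ++ y ∷ [])) →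
                       Unique (y ∷ c₁ ∷ c₂ ∷ ds) →
                       WinsAmong (cycleStrategy y c₁ c₂ ds ch) (y ∷ c₁ ∷ c₂ ∷ ds) y
  cycleStrategy-wins {y} {c₁} {c₂} {ds} (_ , c₁c₂ , ch) (y≢ ∷ c₁≢ ∷ uniq) C Cy≢0 wrongs
    with peel y≢ wrongs
  ... | wrongY , wrongsRest with peel c₁≢ wrongsRest
  ... | wrongC₁ , wrongsTail
    with tailStrategy-invariant c₁ c₂ ds (c₁c₂ , ch) uniq
           (cycleInvariant-start (C y) (C c₁) (C c₂) Cy≢0 wrongC₁) wrongsTail
  ... | b , inv , wrongLast = cycleInvariant-close (C y) (C c₁) b _ inv wrongLast wrongY

  winsAmong⇒winsWithHint : ∀ s L {A} → WinsAmong s L A → WinsWithHintFor G A 0F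
  winsAmong⇒winsWithHint s L wins = s , λ C CA≢0 →
    someoneRight C (¬All⇒Any¬ (λ v → ¬? (Strategy.guess s v C ≟ C v)) L (wins C CA≢0))
    where
    someoneRight : ∀ C → Any (λ v → ¬ Strategy.guess s v C ≢ C v) L →
                   ∃ λ v → Strategy.guess s v C ≡ C v
    someoneRight C notAllWrong with satisfied notAllWrong
    ... | v , notWrong = v , decidable-stable (Strategy.guess s v C ≟ C v) notWrong

  cycle⇒winsWithHint : ∀ A → Connected G → HasCycle G → WinsWithHintFor G A 0F
  cycle⇒winsWithHint A connected (v , ws , long , uniq , closed)
    with pathInto {L = v ∷ ws} (connected A v) (here refl)
  ... | en with rotateCycle closed (target∈ en)
  ... | rs , rot , closedAtY =
    onCycle rs rot closedAtY (subst (2 ≤_) (suc-injective (sym (↭-length rot))) long)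
    where
    onCycle : ∀ rs → (target en ∷ rs) ↭ (v ∷ ws) →
              AdjChain G (target en ∷ rs ++ target en ∷ []) → 2 ≤ length rs →
              WinsWithHintFor G A 0F
    onCycle (_ ∷ [])       _   _         (s≤s ())
    onCycle (c₁ ∷ c₂ ∷ ds) rot closedAtY _ =
      winsAmong⇒winsWithHint (passHintAlong (path en) strategy) _
        (passHintAlong-wins (path en) strategy uniqueLollipop (here refl)
          (cycleStrategy-wins closedAtY uniqueCycle))
      where
      strategy : Strategy G
      strategy = cycleStrategy (target en) c₁ c₂ ds closedAtY

      uniqueCycle : Unique (target en ∷ c₁ ∷ c₂ ∷ ds)
      uniqueCycle = Unique-resp-↭ (↭-sym rot) uniq

      uniqueLollipop : Unique (stem (path en) ++ target en ∷ c₁ ∷ c₂ ∷ ds)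
      uniqueLollipop = Unique.++⁺ (simple en) uniqueCycle λ (z∈stem , z∈cycle) →
        All.lookup (outside en) z∈stem (∈-resp-↭ rot z∈cycle)

  relabel : ∀ {A i} (π : Permutation′ 3) → WinsWithHintFor G A i → WinsWithHintFor G A (π ⟨$⟩ʳ i)
  relabel {A} {i} π (s , wins) = s′ , wins′
    where
    s′ : Strategy G
    s′ = record
      { guess = λ v C → π ⟨$⟩ʳ Strategy.guess s v (λ u → π ⟨$⟩ˡ C u)
      ; local = λ v C C′ agree →
          cong (π ⟨$⟩ʳ_) (Strategy.local s v _ _ λ u vu → cong (π ⟨$⟩ˡ_) (agree u vu)) }

    wins′ : ∀ C → C A ≢ π ⟨$⟩ʳ i → ∃ λ v → Strategy.guess s′ v C ≡ C v
    wins′ C CA≢πi with wins (λ u → π ⟨$⟩ˡ C u)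
                            (λ hit → CA≢πi (trans (sym (inverseʳ π)) (cong (π ⟨$⟩ʳ_) hit)))
    ... | v , right = v , trans (cong (π ⟨$⟩ʳ_) right) (inverseʳ π)

  winsWithHint-everyColour : ∀ {A} → WinsWithHintFor G A 0F → SagesWinWithHint G A
  winsWithHint-everyColour wins i = relabel (transpose 0F i) wins

otherTwo : ∀ (d : Fin 3) → ∃ λ l → ∃ λ l′ → l ≢ l′ × l ≢ d × l′ ≢ d
otherTwo 0F = 1F , 2F , (λ ()) , (λ ()) , (λ ())
otherTwo 1F = 0F , 2F , (λ ()) , (λ ()) , (λ ())
otherTwo 2F = 0F , 1F , (λ ()) , (λ ()) , (λ ())

avoid-two : ∀ (a b : Fin 3) → ∃ λ c → c ≢ a × c ≢ b
avoid-two a b with otherTwo a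
... | l , l′ , l≢l′ , l≢a , l′≢a with l ≟ b
...   | no l≢b   = l , l≢a , l≢b
...   | yes refl = l′ , l′≢a , ≢-sym l≢l′

majority₃ : Fin 3 → Fin 3 → Fin 3 → Fin 3
majority₃ x y z with x ≟ y | x ≟ z
... | no _ | no _ = y
... | _    | _    = x

majority₃-first : ∀ {x y z} → x ≡ y ⊎ x ≡ z → majority₃ x y z ≡ x
majority₃-first {x} {y} {z} agree with x ≟ y | x ≟ z
... | no x≢y | no x≢z = ⊥-elim ([ x≢y , x≢z ] agree)
... | yes _  | _      = refl
... | no _   | yes _  = refl

majority₃-second : ∀ {x y z} → y ≡ z → majority₃ x y z ≡ y
majority₃-second {x} {y} {z} y≡z with x ≟ y | x ≟ z
... | no _    | no _    = refl
... | yes x≡y | _       = x≡y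
... | no _    | yes x≡z = trans x≡z (sym y≡z)

majority : (Fin 3 → Fin 3) → Fin 3
majority f = majority₃ (f 0F) (f 1F) (f 2F)

majority-cong : ∀ {f f′ : Fin 3 → Fin 3} → (∀ l → f l ≡ f′ l) → majority f ≡ majority f′
majority-cong h rewrite h 0F | h 1F | h 2F = refl

majority-agrees : ∀ f {l l′} → l ≢ l′ → f l ≡ f l′ → majority f ≡ f l
majority-agrees f {0F} {0F} l≢l′ _  = ⊥-elim (l≢l′ refl)
majority-agrees f {1F} {1F} l≢l′ _  = ⊥-elim (l≢l′ refl)
majority-agrees f {2F} {2F} l≢l′ _  = ⊥-elim (l≢l′ refl)
majority-agrees f {0F} {1F} _    eq = majority₃-first (inj₁ eq)
majority-agrees f {0F} {2F} _    eq = majority₃-first (inj₂ eq)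
majority-agrees f {1F} {0F} _    eq = trans (majority₃-first (inj₁ (sym eq))) (sym eq)
majority-agrees f {2F} {0F} _    eq = trans (majority₃-first (inj₂ (sym eq))) (sym eq)
majority-agrees f {1F} {2F} _    eq = majority₃-second {f 0F} eq
majority-agrees f {2F} {1F} _    eq = trans (majority₃-second {f 0F} (sym eq)) (sym eq)

-- Of the two colours other than d, at most one is sent to c: otherwise they
-- would form a majority equal to c.
avoid-majority : ∀ (f : Fin 3 → Fin 3) c d → majority f ≢ c → ∃ λ l → l ≢ d × f l ≢ c
avoid-majority f c d m≢c with otherTwo d
... | l , l′ , l≢l′ , l≢d , l′≢d with f l ≟ c | f l′ ≟ c
...   | no fl≢c   | _          = l , l≢d , fl≢c
...   | yes _     | no fl′≢c   = l′ , l′≢d , fl′≢c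
...   | yes fl≡c  | yes fl′≡c  =
  ⊥-elim (m≢c (trans (majority-agrees f l≢l′ (trans fl≡c (sym fl′≡c))) fl≡c))

module ForestLoses {n : ℕ} (G : Graph n) where

  open Paths G
  open import Data.List.Membership.DecPropositional (_≟_ {n}) using (_∈?_)

  private
    V : Set
    V = Fin n

  remove : V → List V → List V
  remove e = filter (λ v → ¬? (v ≟ e))

  ∈-remove⁺ : ∀ {e v S} → v ∈ S → v ≢ e → v ∈ remove e S
  ∈-remove⁺ {e} = ∈-filter⁺ (λ v → ¬? (v ≟ e))

  ∈-remove⁻ : ∀ {e v S} → v ∈ remove e S → v ∈ S × v ≢ e
  ∈-remove⁻ {e} = ∈-filter⁻ (λ v → ¬? (v ≟ e))

  remove-shrinks : ∀ {e S} → e ∈ S → length (remove e S) < length S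
  remove-shrinks {e} {S} e∈S =
    filter-notAll (λ v → ¬? (v ≟ e)) S (Any.map (λ e≡v v≢e → v≢e (sym e≡v)) e∈S)

  -- The path x = x₀, …, x_k = end is stored backwards, as end ∷ trail.
  record MaximalPath (S : List V) (x : V) : Set where
    field
      end     : V
      trail   : List V
      unique  : Unique (end ∷ trail)
      chain   : AdjChain G (end ∷ trail)
      inside  : All (_∈ S) (end ∷ trail)
      origin  : (trail ≡ [] × end ≡ x) ⊎ x ∈ trail
      maximal : ∀ {w} → w ∈ S → Adj G end w → w ∈ end ∷ trail

  unvisited : List V → List V → List V
  unvisited S []       = S
  unvisited S (w ∷ ws) = remove w (unvisited S ws)

  ∈-unvisited : ∀ {S w} ws → w ∈ S → w ∉ ws → w ∈ unvisited S ws
  ∈-unvisited []       w∈S _   = w∈S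
  ∈-unvisited (x ∷ ws) w∈S w∉ = ∈-remove⁺ (∈-unvisited ws w∈S (w∉ ∘ there)) (w∉ ∘ here)

  private
    origin∈ : ∀ {x end : V} {trail} → (trail ≡ [] × end ≡ x) ⊎ x ∈ trail → x ∈ end ∷ trail
    origin∈ (inj₁ (_ , end≡x)) = here (sym end≡x)
    origin∈ (inj₂ x∈trail)     = there x∈trail

    grow : ∀ {S x} end trail → Unique (end ∷ trail) → AdjChain G (end ∷ trail) →
           All (_∈ S) (end ∷ trail) → (trail ≡ [] × end ≡ x) ⊎ x ∈ trail →
           Acc _<_ (length (unvisited S (end ∷ trail))) → MaximalPath S x
    grow {S} end trail uniq ch inS orig (acc smaller)
      with Any.any? (λ w → Adj? end w ×-dec ¬? (w ∈? end ∷ trail)) S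
    ... | no stuck = record
      { end = end ; trail = trail ; unique = uniq ; chain = ch ; inside = inS ; origin = orig
      ; maximal = λ w∈S ew → decidable-stable (_ ∈? _) λ w∉ →
          stuck (Any.map (λ { refl → ew , w∉ }) w∈S) }
    ... | yes found with find found
    ...   | w , w∈S , ew , w∉ =
      grow w (end ∷ trail) (¬Any⇒All¬ _ w∉ ∷ uniq) (Adj-sym ew , ch) (w∈S ∷ inS)
           (inj₂ (origin∈ orig)) (smaller (remove-shrinks (∈-unvisited (end ∷ trail) w∈S w∉)))

  maximalPath : ∀ {S x} → x ∈ S → MaximalPath S x
  maximalPath x∈S = grow _ [] ([] ∷ []) tt (x∈S ∷ []) (inj₁ (refl , refl)) (<-wellFounded _)

  Guesses : Set
  Guesses = V → Placement G → Fin 3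

  LocalOn : List V → Guesses → Set
  LocalOn S g = ∀ {v} → v ∈ S → ∀ C C′ → (∀ {u} → u ∈ S → Adj G v u → C u ≡ C′ u) →
                g v C ≡ g v C′

  _[_≔_] : Placement G → V → Fin 3 → Placement G
  C [ e ≔ l ] = updateAt C e (const l)

  ≔-same : ∀ C e l → (C [ e ≔ l ]) e ≡ l
  ≔-same C e l = updateAt-updates e C

  ≔-other : ∀ C {e v} l → v ≢ e → (C [ e ≔ l ]) v ≡ C v
  ≔-other C {e} {v} l v≢e = updateAt-minimal v e C v≢e

  agreement-extends : ∀ {S e v} {C C′ : Placement G} →
                      (∀ {u} → u ∈ remove e S → Adj G v u → C u ≡ C′ u) → ¬ Adj G v e →
                      ∀ {u} → u ∈ S → Adj G v u → C u ≡ C′ u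
  agreement-extends {e = e} agree ¬ve {u} u∈S vu with u ≟ e
  ... | yes refl = ⊥-elim (¬ve vu)
  ... | no u≢e   = agree (∈-remove⁺ u∈S u≢e) vu

  update-unseen : ∀ {S g v e C} l → LocalOn S g → v ∈ S → ¬ Adj G v e → g v (C [ e ≔ l ]) ≡ g v C
  update-unseen {v = v} {C = C} l local v∈S ¬ve =
    local v∈S _ _ λ _ vu → ≔-other C l λ u≡e → ¬ve (subst (Adj G v) u≡e vu)

  recoloured-wrong : ∀ {S g e C l} → LocalOn S g → e ∈ S → l ≢ g e C →
                     g e (C [ e ≔ l ]) ≢ (C [ e ≔ l ]) e
  recoloured-wrong {e = e} {C} {l} local e∈S l≢guess right =
    l≢guess (trans (sym (≔-same C e l)) (trans (sym right) (update-unseen l local e∈S Adj-irrefl)))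

  stays-wrong : ∀ {S g e v C} l → LocalOn S g → v ∈ S → v ≢ e → ¬ Adj G v e →
                g v C ≢ C v → g v (C [ e ≔ l ]) ≢ (C [ e ≔ l ]) v
  stays-wrong {C = C} l local v∈S v≢e ¬ve wrong right =
    wrong (trans (sym (update-unseen l local v∈S ¬ve)) (trans right (≔-other C l v≢e)))

  restrict-local : ∀ {S g e} → LocalOn S g → (∀ {w} → w ∈ S → ¬ Adj G e w) → LocalOn (remove e S) g
  restrict-local local lonely v∈S′ C C′ agree =
    local (proj₁ (∈-remove⁻ v∈S′)) C C′
      (agreement-extends agree (lonely (proj₁ (∈-remove⁻ v∈S′)) ∘ Adj-sym))

  absorb : V → V → Guesses → Guesses
  absorb p e g v C with v ≟ p
  ... | yes _ = majority (λ l → g p (C [ e ≔ l ]))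
  ... | no _  = g v C

  absorb-at : ∀ p e g C → absorb p e g p C ≡ majority (λ l → g p (C [ e ≔ l ]))
  absorb-at p e g C with p ≟ p
  ... | yes _  = refl
  ... | no p≢p = ⊥-elim (p≢p refl)

  absorb-elsewhere : ∀ {p} e g {v} C → v ≢ p → absorb p e g v C ≡ g v C
  absorb-elsewhere {p} e g {v} C v≢p with v ≟ p
  ... | yes v≡p = ⊥-elim (v≢p v≡p)
  ... | no _    = refl

  absorb-local : ∀ {S g e p} → LocalOn S g → p ∈ S → (∀ {w} → w ∈ S → Adj G e w → w ≡ p) →
                 LocalOn (remove e S) (absorb p e g)
  absorb-local {S} {g} {e} {p} local p∈S only {v} v∈S′ C C′ agree with v ≟ p
  ... | yes refl = majority-cong λ l → local p∈S _ _ λ {u} u∈S pu → updates-agree l u∈S pu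
    where
    updates-agree : ∀ l {u} → u ∈ S → Adj G p u → (C [ e ≔ l ]) u ≡ (C′ [ e ≔ l ]) u
    updates-agree l {u} u∈S pu with u ≟ e
    ... | yes refl = trans (≔-same C e l) (sym (≔-same C′ e l))
    ... | no u≢e   = trans (≔-other C l u≢e)
                       (trans (agree (∈-remove⁺ u∈S u≢e) pu) (sym (≔-other C′ l u≢e)))
  ... | no v≢p = local v∈S C C′ (agreement-extends agree λ ve → v≢p (only v∈S (Adj-sym ve)))
    where
    v∈S : v ∈ S
    v∈S = proj₁ (∈-remove⁻ v∈S′)

  module _ (acyclic : ¬ HasCycle G) (A : V) where

    data Leaf (S : List V) : Set where
      isolated : ∀ {e} → e ∈ S → (∀ {w} → w ∈ S → ¬ Adj G e w) → Leaf S
      pendant  : ∀ {e p} → e ∈ S → e ≢ A → p ∈ S → Adj G e p →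
                 (∀ {w} → w ∈ S → Adj G e w → w ≡ p) → Leaf S

    endpointLeaf : ∀ {S x} → MaximalPath S x → x ≡ A ⊎ A ∉ S → Leaf S
    endpointLeaf record { end = e ; trail = [] ; inside = e∈S ∷ _ ; maximal = maximal } _ =
      isolated e∈S lonely
      where
      lonely : ∀ {w} → w ∈ _ → ¬ Adj G e w
      lonely w∈S ew with maximal w∈S ew
      ... | here refl = Adj-irrefl ew
    endpointLeaf {S} {x} record { end = e ; trail = q ∷ rest ; unique = e≢trail ∷ uniq
                                ; chain = eq , ch ; inside = e∈S ∷ q∈S ∷ _
                                ; origin = origin ; maximal = maximal } start =
      pendant e∈S e≢A q∈S eq onlyNeighbour
      where
      e≢A : e ≢ A
      e≢A = apart start origin
        where
        apart : x ≡ A ⊎ A ∉ S → (q ∷ rest ≡ [] × e ≡ x) ⊎ x ∈ q ∷ rest → e ≢ A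
        apart (inj₂ A∉S) _              e≡A = A∉S (subst (_∈ S) e≡A e∈S)
        apart (inj₁ x≡A) (inj₂ x∈trail) e≡A = All.lookup e≢trail x∈trail (trans e≡A (sym x≡A))
        apart (inj₁ _)   (inj₁ (() , _))

      onlyNeighbour : ∀ {w} → w ∈ S → Adj G e w → w ≡ q
      onlyNeighbour w∈S ew with maximal w∈S ew
      ... | here refl            = ⊥-elim (Adj-irrefl ew)
      ... | there (here w≡q)     = w≡q
      ... | there (there w∈rest) =
        ⊥-elim (acyclic (backEdge⇒cycle (e≢trail ∷ uniq) (eq , ch) w∈rest ew))

    findLeaf : ∀ {u S} → u ∈ S → Leaf S
    findLeaf {S = S} u∈S with A ∈? S
    ... | yes A∈S = endpointLeaf (maximalPath A∈S) (inj₁ refl)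
    ... | no A∉S  = endpointLeaf (maximalPath u∈S) (inj₂ A∉S)

    module _ (i : Fin 3) where

      Defeat : List V → Guesses → Set
      Defeat S g = Σ (Placement G) λ C → C A ≢ i × All (λ v → g v C ≢ C v) S

      defeat-isolated : ∀ {S g e} → LocalOn S g → e ∈ S → (∀ {w} → w ∈ S → ¬ Adj G e w) →
                        Defeat (remove e S) g → Defeat S g
      defeat-isolated {S} {g} {e} local e∈S lonely (C , CA≢i , wrongs) with avoid-two (g e C) i
      ... | l , l≢guess , l≢i = C [ e ≔ l ] , C′A≢i , All.tabulate wrong′
        where
        C′A≢i : (C [ e ≔ l ]) A ≢ i
        C′A≢i with A ≟ e
        ... | yes refl = λ hit → l≢i (trans (sym (≔-same C A l)) hit)
        ... | no A≢e   = λ hit → CA≢i (trans (sym (≔-other C l A≢e)) hit)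

        wrong′ : ∀ {v} → v ∈ S → g v (C [ e ≔ l ]) ≢ (C [ e ≔ l ]) v
        wrong′ {v} v∈S with v ≟ e
        ... | yes refl = recoloured-wrong local e∈S l≢guess
        ... | no v≢e   = stays-wrong l local v∈S v≢e (lonely v∈S ∘ Adj-sym)
                           (All.lookup wrongs (∈-remove⁺ v∈S v≢e))

      defeat-pendant : ∀ {S g e p} → LocalOn S g → e ∈ S → e ≢ A → p ∈ S → Adj G e p →
                       (∀ {w} → w ∈ S → Adj G e w → w ≡ p) →
                       Defeat (remove e S) (absorb p e g) → Defeat S g
      defeat-pendant {S} {g} {e} {p} local e∈S e≢A p∈S ep only (C , CA≢i , wrongs)
        with avoid-majority (λ l → g p (C [ e ≔ l ])) (C p) (g e C)
               (λ hit → All.lookup wrongs (∈-remove⁺ p∈S (≢-sym (Adj⇒≢ ep)))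
                          (trans (absorb-at p e g C) hit))
      ... | l , l≢guess , pWrong =
        C [ e ≔ l ] , (λ hit → CA≢i (trans (sym (≔-other C l (≢-sym e≢A))) hit)) , All.tabulate wrong′
        where
        wrong′ : ∀ {v} → v ∈ S → g v (C [ e ≔ l ]) ≢ (C [ e ≔ l ]) v
        wrong′ {v} v∈S with v ≟ e | v ≟ p
        ... | yes refl | _        = recoloured-wrong local e∈S l≢guess
        ... | no v≢e   | yes refl = λ right → pWrong (trans right (≔-other C l v≢e))
        ... | no v≢e   | no v≢p   =
          stays-wrong l local v∈S v≢e (λ ve → v≢p (only v∈S (Adj-sym ve)))
            (λ right → All.lookup wrongs (∈-remove⁺ v∈S v≢e) (trans (absorb-elsewhere e g C v≢p) right))

      defeat : ∀ S → Acc _<_ (length S) → ∀ g → LocalOn S g → Defeat S g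
      defeat [] _ g _ with avoid-two i i
      ... | c , c≢i , _ = const c , c≢i , []
      defeat S@(_ ∷ _) (acc smaller) g local with findLeaf (here refl)
      ... | isolated e∈S lonely =
        defeat-isolated local e∈S lonely
          (defeat _ (smaller (remove-shrinks e∈S)) g (restrict-local local lonely))
      ... | pendant e∈S e≢A p∈S ep only =
        defeat-pendant local e∈S e≢A p∈S ep only
          (defeat _ (smaller (remove-shrinks e∈S)) (absorb _ _ g) (absorb-local local p∈S only))

  forest⇒loses : ¬ HasCycle G → ∀ A → SagesLoseWithHint G A
  forest⇒loses acyclic A win with win 0F
  ... | s , wins
    with defeat acyclic A 0F (allFin n) (<-wellFounded _) (Strategy.guess s)
           (λ _ C C′ agree → Strategy.local s _ C C′ λ u → agree (∈-allFin u))
  ... | C , CA≢0 , wrongs with wins C CA≢0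
  ... | v , right = All.lookup wrongs (∈-allFin v) right

theorem13 : ∀ {n : ℕ} (G : Graph n) (A : Fin n) → Connected G →
              (SagesLoseWithHint G A ⇔ IsTree G)
theorem13 G A connected = mk⇔
  (λ loses → connected , λ cycle → loses (winsWithHint-everyColour (cycle⇒winsWithHint A connected cycle)))
  (λ tree → forest⇒loses (proj₂ tree) A)
  where
  open CycleWins G
  open ForestLoses G
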